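{- Let $H$ be a finite simple graph on eight or nine vertices with minimum degree $\delta(H)\ge 5$. Then there is a vertex $v\in V(H)$ such that $H\setminus v$ has a $\mathcal{K}_7^{ -6}$ minor, i.e. $H\setminus v$ has a minor isomorphic to some graph obtained from $K_7$ by deleting exactly $6$ edges.
   Context: All graphs are finite, undirected, without loops or parallel edges. $H\setminus v$ denotes the graph obtained from $H$ by deleting the vertex $v$. A graph $F$ is a minor of $G$ if $F$ can be obtained from a subgraph of $G$ by contracting edges. For positive integers $t,s$, $\mathcal{K}_t^{ -s}$ denotes the family of all graphs obtained from $K_t$ by deleting $s$ edges; $G$ has a $\mathcal{K}_t^{ -s}$ minor if it has an $F$ minor for some $F\in\mathcal{K}_t^{ -s}$. -}

module Defs where

open import Data.Bool using (Bool; true; false; if_then_else_; not; _∧_)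
open import Data.Nat using (ℕ; suc; _<ᵇ_)
open import Data.Fin using (Fin; toℕ; punchIn)
open import Data.List using (List; map; allFin)
open import Data.Nat.ListAction using (sum)
open import Data.Product using (Σ; ∃; _×_; _,_)
open import Relation.Binary.PropositionalEquality using (_≡_; _≢_)

record Graph (n : ℕ) : Set where
  field
    adj    : Fin n → Fin n → Bool
    adj-sym : ∀ i j → adj i j ≡ adj j i
    irrefl : ∀ i → adj i i ≡ false
open Graph public

deg : ∀ {n} → Graph n → Fin n → ℕ
deg {n} G v = sum (map (λ w → if adj G v w then 1 else 0) (allFin n))

minDeg≥ : ∀ {n} → Graph n → ℕ → Set
minDeg≥ {n} G d = ∀ (v : Fin n) → d Data.Nat.≤ deg G v

_∖_ : ∀ {m} → Graph (suc m) → Fin (suc m) → Graph m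
adj    (G ∖ v) i j = adj G (punchIn v i) (punchIn v j)
adj-sym (G ∖ v) i j = Graph.adj-sym G (punchIn v i) (punchIn v j)
irrefl (G ∖ v) i   = Graph.irrefl G (punchIn v i)

nonEdges : ∀ {n} → Graph n → ℕ
nonEdges {n} G =
  sum (map (λ i → sum (map (λ j → if (toℕ i <ᵇ toℕ j) ∧ not (adj G i j) then 1 else 0)
                               (allFin n)))
           (allFin n))

data Walk {n} (G : Graph n) (P : Fin n → Set) : Fin n → Fin n → Set where
  here : ∀ {x} → P x → Walk G P x x
  step : ∀ {x y z} → P x → adj G x y ≡ true → Walk G P y z → Walk G P x z

record MinorModel {k n} (F : Graph k) (G : Graph n) : Set where
  field
    branch    : Fin k → Fin n → Bool
    nonempty  : ∀ i → ∃ λ x → branch i x ≡ true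
    disjoint  : ∀ i j x → i ≢ j → branch i x ≡ true → branch j x ≡ false
    connected : ∀ i x y → branch i x ≡ true → branch i y ≡ true
                → Walk G (λ z → branch i z ≡ true) x y
    edges     : ∀ i j → adj F i j ≡ true
                → Σ (Fin n) λ x → Σ (Fin n) λ y →
                    branch i x ≡ true × branch j y ≡ true × adj G x y ≡ true

_≼_ : ∀ {k n} → Graph k → Graph n → Set
F ≼ G = MinorModel F G

-- G has a K_t^{-s} minor: a minor F obtained from K_t by deleting exactly s edges
HasKMinusMinor : ℕ → ℕ → ∀ {n} → Graph n → Set
HasKMinusMinor t s G = Σ (Graph t) λ F → nonEdges F ≡ s × F ≼ G

-- Write codeg v for the number of non-neighbours of v.  The codegrees sum to twice the
-- number of non-edges, and minimum degree 5 on n vertices means codeg ≤ n − 6.  Deleting a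
-- vertex v of maximum codegree d removes 2d from the codegree sum, leaving at most (n − 2) d.
-- For n = 8 this is at most 12, so H ∖ v has at most 6 non-edges and deleting further edges
-- gives a member of K₇⁻⁶.  For n = 9, K = H ∖ v has codegrees at most 3 and codegree sum at
-- most 21, hence at most 20 by parity.  Contracting an edge xy of K, where x has maximum
-- codegree t, lowers the codegree sum by at least 2 |N̄(x) ∪ N̄(y)|.  If t ≤ 2 this leaves at
-- most 8t − 2t ≤ 12.  If t = 3, either some neighbour y of x has a non-neighbour outside
-- N̄(x), so the union has at least 4 elements and 20 − 8 = 12; or every neighbour of x has
-- its non-neighbours inside N̄(x), which bounds the codegree sum by 3·4 + 2·3 = 18, and
-- 18 − 6 = 12.

module Submission where

open import Defs
open import Data.Bool using (Bool; true; false; if_then_else_; not; _∧_; _∨_)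
open import Data.Bool.Properties
  using (∧-zeroʳ; ∧-identityʳ; ∨-identityʳ; ∨-zeroʳ; ∨-comm; ∧-comm; ¬-not) renaming (_≟_ to _≟ᵇ_)
open import Data.Nat using (ℕ; zero; suc; _+_; _*_; _∸_; _≤_; _<_; z≤n; s≤s; _≤?_; _<ᵇ_)
open import Data.Nat.Properties
  using (≤-refl; ≤-trans; ≤-reflexive; ≤-antisym; +-identityʳ; *-zeroʳ; *-identityʳ; +-mono-≤;
        +-mono-<-≤; +-monoʳ-≤; +-comm; +-assoc; +-suc; m+n∸m≡n; m+[n∸m]≡n; ∸-monoʳ-≤; ∸-monoˡ-≤;
        m≤n+m; m≤m+n; m<m+n; +-cancelˡ-≤; +-cancelʳ-≤; *-distribʳ-+; *-cancelˡ-≡; *-cancelˡ-≤;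
        *-suc; *-monoʳ-≤; *-monoʳ-<; <⇒≱; <-irrefl; ≮⇒≥; ≰⇒>; +-*-semiring; module ≤-Reasoning)
open import Data.Fin using (Fin; zero; suc; toℕ; punchIn; _≟_)
open import Data.Fin.Properties using (any?; punchIn-injective; punchInᵢ≢i)
open import Data.List using (map; allFin; tabulate)
import Data.Nat.ListAction as List
open import Data.List.Extrema.Nat using (argmax; f[xs]≤f[argmax])
open import Data.List.Membership.Propositional.Properties using (∈-allFin)
import Data.List.Relation.Unary.All as All
open import Algebra.Properties.Semiring.Sum +-*-semiring
  using (sum-syntax; sum-cong-≗; ∑-distrib-+; ∑-comm; sum-remove; *-distribˡ-sum)
open import Data.Product using (Σ; _×_; _,_; proj₁; proj₂)
open import Data.Sum using (_⊎_; inj₁; inj₂)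
open import Data.Empty using (⊥-elim)
open import Relation.Nullary using (Dec; yes; no; does; _×-dec_)
open import Relation.Nullary.Decidable using (dec-true; dec-false)
open import Relation.Binary.PropositionalEquality
  using (_≡_; _≢_; refl; sym; trans; cong; cong₂; subst; module ≡-Reasoning)
open import Function using (_∘_; id)

-- Stated with if_then_else_ so that deg and nonEdges from Defs unfold to sums of brackets.
[_] : Bool → ℕ
[ b ] = if b then 1 else 0

∧≡true⇒ˡ : ∀ {p q} → p ∧ q ≡ true → p ≡ true
∧≡true⇒ˡ {true} _ = refl

∧≡true⇒ʳ : ∀ p {q} → p ∧ q ≡ true → q ≡ true
∧≡true⇒ʳ true q = q

[]≤[∨] : ∀ p q → [ p ] ≤ [ p ∨ q ]
[]≤[∨] true q = ≤-refl
[]≤[∨] false q = z≤n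

[∧¬]+[]≡[∨] : ∀ p q → [ p ∧ not q ] + [ q ] ≡ [ p ∨ q ]
[∧¬]+[]≡[∨] true true = refl
[∧¬]+[]≡[∨] true false = refl
[∧¬]+[]≡[∨] false true = refl
[∧¬]+[]≡[∨] false false = refl

[not∧]∧ : ∀ e q → not (not e ∧ q) ∧ not e ≡ not q ∧ not e
[not∧]∧ true q = sym (∧-zeroʳ (not q))
[not∧]∧ false q = refl

[¬∨]+[¬∧¬¬]≡[¬] : ∀ p q → [ not (p ∨ q) ] + [ not p ∧ not (not q) ] ≡ [ not p ]
[¬∨]+[¬∧¬¬]≡[¬] true q = refl
[¬∨]+[¬∧¬¬]≡[¬] false true = refl
[¬∨]+[¬∧¬¬]≡[¬] false false = refl

-- Computes on constructors: suc i == suc j is definitionally i == j.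
_==_ : ∀ {n} → Fin n → Fin n → Bool
i == j = does (i ≟ j)

==-refl : ∀ {n} (i : Fin n) → (i == i) ≡ true
==-refl i = dec-true (i ≟ i) refl

≢⇒==-false : ∀ {n} {i j : Fin n} → i ≢ j → (i == j) ≡ false
≢⇒==-false {i = i} {j} = dec-false (i ≟ j)

==⇒≡ : ∀ {n} (i j : Fin n) → (i == j) ≡ true → i ≡ j
==⇒≡ i j eq with i ≟ j
... | yes i≡j = i≡j

==-sym : ∀ {n} (i j : Fin n) → (i == j) ≡ (j == i)
==-sym i j with i ≟ j
... | yes refl = sym (==-refl i)
... | no i≢j = sym (≢⇒==-false (i≢j ∘ sym))

punchIn-== : ∀ {n} (p : Fin (suc n)) (i j : Fin n) → (punchIn p i == punchIn p j) ≡ (i == j)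
punchIn-== p i j with i ≟ j
... | yes refl = ==-refl (punchIn p i)
... | no i≢j = ≢⇒==-false (i≢j ∘ punchIn-injective p i j)

punchIn-==-pivot : ∀ {n} (p : Fin (suc n)) (i : Fin n) → (punchIn p i == p) ≡ false
punchIn-==-pivot p i = ≢⇒==-false (punchInᵢ≢i p i)

∑-const : ∀ n c → ∑[ i < n ] c ≡ n * c
∑-const zero c = refl
∑-const (suc n) c = cong (c +_) (∑-const n c)

∑-zero : ∀ {n} {f : Fin n → ℕ} → (∀ i → f i ≡ 0) → ∑[ i < n ] f i ≡ 0
∑-zero {n} f≡0 = trans (sum-cong-≗ f≡0) (trans (∑-const n 0) (*-zeroʳ n))

∑-mono-≤ : ∀ {n} {f g : Fin n → ℕ} → (∀ i → f i ≤ g i) → ∑[ i < n ] f i ≤ ∑[ i < n ] g i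
∑-mono-≤ {zero} f≤g = z≤n
∑-mono-≤ {suc n} f≤g = +-mono-≤ (f≤g zero) (∑-mono-≤ (f≤g ∘ suc))

∑-mono-< : ∀ {n} {f g : Fin n → ℕ} (k : Fin n) →
           (∀ i → f i ≤ g i) → f k < g k → ∑[ i < n ] f i < ∑[ i < n ] g i
∑-mono-< {suc n} {f} {g} k f≤g fk<gk
  rewrite sum-remove {i = k} f | sum-remove {i = k} g =
  +-mono-<-≤ fk<gk (∑-mono-≤ (f≤g ∘ punchIn k))

∑-≤-* : ∀ {n} {f : Fin n → ℕ} c → (∀ i → f i ≤ c) → ∑[ i < n ] f i ≤ n * c
∑-≤-* {n} c f≤c = ≤-trans (∑-mono-≤ f≤c) (≤-reflexive (∑-const n c))

∑-[==∧] : ∀ {n} (p : Fin n) (b : Bool) → ∑[ i < n ] [ (i == p) ∧ b ] ≡ [ b ]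
∑-[==∧] {suc n} p b = begin
  ∑[ i < suc n ] [ (i == p) ∧ b ]
    ≡⟨ sum-remove {i = p} (λ i → [ (i == p) ∧ b ]) ⟩
  [ (p == p) ∧ b ] + ∑[ i < n ] [ (punchIn p i == p) ∧ b ]
    ≡⟨ cong₂ _+_ (cong (λ e → [ e ∧ b ]) (==-refl p))
                 (∑-zero (λ i → cong (λ e → [ e ∧ b ]) (punchIn-==-pivot p i))) ⟩
  [ b ] + 0
    ≡⟨ +-identityʳ [ b ] ⟩
  [ b ] ∎
  where open ≡-Reasoning

∑-[==] : ∀ {n} (p : Fin n) → ∑[ i < n ] [ i == p ] ≡ 1
∑-[==] {n} p = trans (sum-cong-≗ (λ i → cong [_] (sym (∧-identityʳ (i == p))))) (∑-[==∧] p true)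

sum-map-tabulate : ∀ n {A : Set} (f : Fin n → A) (g : A → ℕ) →
                   List.sum (map g (tabulate f)) ≡ ∑[ i < n ] g (f i)
sum-map-tabulate zero f g = refl
sum-map-tabulate (suc n) f g = cong (g (f zero) +_) (sum-map-tabulate n (f ∘ suc) g)

maximiser : ∀ {n} (f : Fin (suc n) → ℕ) → Σ (Fin (suc n)) λ v → ∀ u → f u ≤ f v
maximiser {n} f =
  argmax f zero (allFin (suc n)) , λ u → All.lookup (f[xs]≤f[argmax] {f = f} zero (allFin (suc n))) (∈-allFin u)

∑∑-distrib-+ : ∀ {m n} (f g : Fin m → Fin n → ℕ) →
               ∑[ i < m ] ∑[ j < n ] (f i j + g i j) ≡ ∑[ i < m ] ∑[ j < n ] f i j + ∑[ i < m ] ∑[ j < n ] g i j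
∑∑-distrib-+ {n = n} f g = trans (sum-cong-≗ (λ i → ∑-distrib-+ (f i) (g i)))
                                 (∑-distrib-+ (λ i → ∑[ j < n ] f i j) (λ i → ∑[ j < n ] g i j))

∑∑-[==∧] : ∀ {n} (p : Fin n) (c : Fin n → Bool) →
           ∑[ a < n ] ∑[ b < n ] [ (a == p) ∧ c b ] ≡ ∑[ b < n ] [ c b ]
∑∑-[==∧] p c = trans (∑-comm (λ a b → [ (a == p) ∧ c b ])) (sum-cong-≗ λ b → ∑-[==∧] p (c b))

-- Codegrees

nonAdj : ∀ {n} → Graph n → Fin n → Fin n → Bool
nonAdj G a b = not (adj G a b) ∧ not (a == b)

nonAdj-sym : ∀ {n} (G : Graph n) a b → nonAdj G a b ≡ nonAdj G b a
nonAdj-sym G a b = cong₂ (λ e f → not e ∧ not f) (adj-sym G a b) (==-sym a b)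

nonAdj-irrefl : ∀ {n} (G : Graph n) a → nonAdj G a a ≡ false
nonAdj-irrefl G a rewrite ==-refl a = ∧-zeroʳ (not (adj G a a))

adj⇒¬nonAdj : ∀ {n} (G : Graph n) {a b} → adj G a b ≡ true → nonAdj G a b ≡ false
adj⇒¬nonAdj G ab rewrite ab = refl

adj⇒≢ : ∀ {n} (G : Graph n) {a b} → adj G a b ≡ true → a ≢ b
adj⇒≢ G {a} ab refl with () ← trans (sym ab) (irrefl G a)

codeg : ∀ {n} → Graph n → Fin n → ℕ
codeg {n} G a = ∑[ b < n ] [ nonAdj G a b ]

deg≡∑ : ∀ {n} (G : Graph n) u → deg G u ≡ ∑[ w < n ] [ adj G u w ]
deg≡∑ {n} G u = sum-map-tabulate n id (λ w → [ adj G u w ])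

suc[deg+codeg]≡n : ∀ {n} (G : Graph n) u → suc (deg G u + codeg G u) ≡ n
suc[deg+codeg]≡n {n} G u = begin
  suc (deg G u + codeg G u)
    ≡⟨ +-comm 1 _ ⟩
  deg G u + codeg G u + 1
    ≡⟨ cong₂ (λ d e → d + codeg G u + e) (deg≡∑ G u) (sym (∑-[==] u)) ⟩
  ∑[ w < n ] [ adj G u w ] + ∑[ w < n ] [ nonAdj G u w ] + ∑[ w < n ] [ w == u ]
    ≡⟨ cong (_+ ∑[ w < n ] [ w == u ]) (sym (∑-distrib-+ (λ w → [ adj G u w ]) (λ w → [ nonAdj G u w ]))) ⟩
  ∑[ w < n ] ([ adj G u w ] + [ nonAdj G u w ]) + ∑[ w < n ] [ w == u ]
    ≡⟨ sym (∑-distrib-+ (λ w → [ adj G u w ] + [ nonAdj G u w ]) (λ w → [ w == u ])) ⟩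
  ∑[ w < n ] ([ adj G u w ] + [ nonAdj G u w ] + [ w == u ])
    ≡⟨ sum-cong-≗ partition ⟩
  ∑[ w < n ] 1
    ≡⟨ trans (∑-const n 1) (*-identityʳ n) ⟩
  n ∎
  where
  open ≡-Reasoning
  partition : ∀ w → [ adj G u w ] + [ nonAdj G u w ] + [ w == u ] ≡ 1
  partition w with w ≟ u
  ... | yes refl rewrite irrefl G w | ==-refl w = refl
  ... | no w≢u rewrite ≢⇒==-false (w≢u ∘ sym) with adj G u w
  ... | true = refl
  ... | false = refl

codeg≡n∸suc[deg] : ∀ {n} (G : Graph n) u → codeg G u ≡ n ∸ suc (deg G u)
codeg≡n∸suc[deg] {n} G u = begin
  codeg G u                                  ≡⟨ sym (m+n∸m≡n (deg G u) (codeg G u)) ⟩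
  suc (deg G u + codeg G u) ∸ suc (deg G u)  ≡⟨ cong (_∸ suc (deg G u)) (suc[deg+codeg]≡n G u) ⟩
  n ∸ suc (deg G u)                          ∎
  where open ≡-Reasoning

minDeg⇒codeg≤ : ∀ {n} (G : Graph n) {d} → minDeg≥ G d → ∀ u → codeg G u ≤ n ∸ suc d
minDeg⇒codeg≤ {n} G δ u = ≤-trans (≤-reflexive (codeg≡n∸suc[deg] G u)) (∸-monoʳ-≤ n (s≤s (δ u)))

[<∧]+[>∧] : ∀ {n} (i j : Fin n) b →
            [ (toℕ i <ᵇ toℕ j) ∧ b ] + [ (toℕ j <ᵇ toℕ i) ∧ b ] ≡ [ b ∧ not (i == j) ]
[<∧]+[>∧] zero zero b = cong [_] (sym (∧-zeroʳ b))
[<∧]+[>∧] zero (suc j) b = trans (+-identityʳ [ b ]) (cong [_] (sym (∧-identityʳ b)))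
[<∧]+[>∧] (suc i) zero b = cong [_] (sym (∧-identityʳ b))
[<∧]+[>∧] (suc i) (suc j) b = [<∧]+[>∧] i j b

nonEdges≡∑∑ : ∀ {n} (G : Graph n) →
              nonEdges G ≡ ∑[ i < n ] ∑[ j < n ] [ (toℕ i <ᵇ toℕ j) ∧ not (adj G i j) ]
nonEdges≡∑∑ {n} G = trans (sum-map-tabulate n id row) (sum-cong-≗ (λ i →
                       sum-map-tabulate n id (λ j → [ (toℕ i <ᵇ toℕ j) ∧ not (adj G i j) ])))
  where
  row : Fin n → ℕ
  row i = List.sum (map (λ j → [ (toℕ i <ᵇ toℕ j) ∧ not (adj G i j) ]) (allFin n))

2*nonEdges≡∑codeg : ∀ {n} (G : Graph n) → 2 * nonEdges G ≡ ∑[ a < n ] codeg G a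
2*nonEdges≡∑codeg {n} G = begin
  2 * nonEdges G
    ≡⟨ cong (nonEdges G +_) (+-identityʳ (nonEdges G)) ⟩
  nonEdges G + nonEdges G
    ≡⟨ cong₂ _+_ (nonEdges≡∑∑ G) (trans (nonEdges≡∑∑ G) (trans (∑-comm ordered) (sum-cong-≗ λ a →
         sum-cong-≗ λ b → cong (λ e → [ (toℕ b <ᵇ toℕ a) ∧ not e ]) (adj-sym G b a)))) ⟩
  ∑[ a < n ] ∑[ b < n ] ordered a b + ∑[ a < n ] ∑[ b < n ] reversed a b
    ≡⟨ sym (∑∑-distrib-+ ordered reversed) ⟩
  ∑[ a < n ] ∑[ b < n ] (ordered a b + reversed a b)
    ≡⟨ sum-cong-≗ (λ a → sum-cong-≗ λ b → [<∧]+[>∧] a b (not (adj G a b))) ⟩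
  ∑[ a < n ] codeg G a ∎
  where
  open ≡-Reasoning
  ordered : Fin n → Fin n → ℕ
  ordered a b = [ (toℕ a <ᵇ toℕ b) ∧ not (adj G a b) ]
  reversed : Fin n → Fin n → ℕ
  reversed a b = [ (toℕ b <ᵇ toℕ a) ∧ not (adj G a b) ]

-- Deleting vertices and edges

codeg-punchIn : ∀ {n} (H : Graph (suc n)) v a →
                codeg H (punchIn v a) ≡ [ nonAdj H (punchIn v a) v ] + codeg (H ∖ v) a
codeg-punchIn {n} H v a = trans (sum-remove {i = v} (λ b → [ nonAdj H (punchIn v a) b ]))
  (cong ([ nonAdj H (punchIn v a) v ] +_) (sum-cong-≗ λ b →
    cong (λ e → [ not (adj H (punchIn v a) (punchIn v b)) ∧ not e ]) (punchIn-== v a b)))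

codeg-∖≤ : ∀ {n} (H : Graph (suc n)) v a → codeg (H ∖ v) a ≤ codeg H (punchIn v a)
codeg-∖≤ H v a = ≤-trans (m≤n+m _ _) (≤-reflexive (sym (codeg-punchIn H v a)))

∑codeg-∖ : ∀ {n} (H : Graph (suc n)) v →
           ∑[ a < suc n ] codeg H a ≡ 2 * codeg H v + ∑[ a < n ] codeg (H ∖ v) a
∑codeg-∖ {n} H v = begin
  ∑[ a < suc n ] codeg H a
    ≡⟨ sum-remove {i = v} (codeg H) ⟩
  codeg H v + ∑[ a < n ] codeg H (punchIn v a)
    ≡⟨ cong (codeg H v +_) (trans (sum-cong-≗ (codeg-punchIn H v)) (∑-distrib-+ _ (codeg (H ∖ v)))) ⟩
  codeg H v + (∑[ a < n ] [ nonAdj H (punchIn v a) v ] + ∑[ a < n ] codeg (H ∖ v) a)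
    ≡⟨ cong (λ c → codeg H v + (c + ∑[ a < n ] codeg (H ∖ v) a)) nonNbrs-of-v ⟩
  codeg H v + (codeg H v + ∑[ a < n ] codeg (H ∖ v) a)
    ≡⟨ sym (+-assoc (codeg H v) _ _) ⟩
  codeg H v + codeg H v + ∑[ a < n ] codeg (H ∖ v) a
    ≡⟨ cong (λ c → codeg H v + c + ∑[ a < n ] codeg (H ∖ v) a) (sym (+-identityʳ (codeg H v))) ⟩
  2 * codeg H v + ∑[ a < n ] codeg (H ∖ v) a ∎
  where
  open ≡-Reasoning
  nonNbrs-of-v : ∑[ a < n ] [ nonAdj H (punchIn v a) v ] ≡ codeg H v
  nonNbrs-of-v = sym (trans (sum-remove {i = v} (λ b → [ nonAdj H v b ]))
    (cong₂ _+_ (cong [_] (nonAdj-irrefl H v)) (sum-cong-≗ λ a → cong [_] (nonAdj-sym H v (punchIn v a)))))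

∑codeg-∖-maximiser : ∀ {n} (H : Graph (suc n)) v → (∀ u → codeg H u ≤ codeg H v) →
                     ∑[ a < n ] codeg (H ∖ v) a ≤ (n ∸ 1) * codeg H v
∑codeg-∖-maximiser {zero} H v max = z≤n
∑codeg-∖-maximiser {suc k} H v max = +-cancelˡ-≤ (2 * c) _ _ (begin
  2 * c + ∑[ a < suc k ] codeg (H ∖ v) a ≡⟨ sym (∑codeg-∖ H v) ⟩
  ∑[ a < suc (suc k) ] codeg H a         ≤⟨ ∑-≤-* c max ⟩
  (2 + k) * c                            ≡⟨ *-distribʳ-+ c 2 k ⟩
  2 * c + k * c                          ∎)
  where
  open ≤-Reasoning
  c : ℕ
  c = codeg H v

isPair : ∀ {n} → Fin n → Fin n → Fin n → Fin n → Bool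
isPair a b i j = ((i == a) ∧ (j == b)) ∨ ((i == b) ∧ (j == a))

isPair-sym : ∀ {n} (a b i j : Fin n) → isPair a b i j ≡ isPair a b j i
isPair-sym a b i j = trans (∨-comm ((i == a) ∧ (j == b)) _)
  (cong₂ _∨_ (∧-comm (i == b) (j == a)) (∧-comm (i == a) (j == b)))

isPair⇒ : ∀ {n} {a b i j : Fin n} → isPair a b i j ≡ true → (i ≡ a × j ≡ b) ⊎ (i ≡ b × j ≡ a)
isPair⇒ {a = a} {b} {i} {j} p with i ≟ a | j ≟ b | i ≟ b | j ≟ a
... | yes i≡a | yes j≡b | _ | _ = inj₁ (i≡a , j≡b)
... | yes _ | no _ | yes i≡b | yes j≡a = inj₂ (i≡b , j≡a)
... | no _ | _ | yes i≡b | yes j≡a = inj₂ (i≡b , j≡a)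

[isPair] : ∀ {n} {a b : Fin n} → a ≢ b → ∀ i j →
           [ isPair a b i j ] ≡ [ (j == b) ∧ (i == a) ] + [ (j == a) ∧ (i == b) ]
[isPair] {a = a} {b} a≢b i j with i ≟ a | i ≟ b
... | yes refl | yes refl = ⊥-elim (a≢b refl)
... | yes refl | no _ rewrite ∨-identityʳ (j == b) | ∧-identityʳ (j == b) | ∧-zeroʳ (j == i) =
  sym (+-identityʳ [ j == b ])
... | no _ | yes refl rewrite ∧-identityʳ (j == a) | ∧-zeroʳ (j == i) = refl
... | no _ | no _ rewrite ∧-zeroʳ (j == b) | ∧-zeroʳ (j == a) = refl

removeEdge : ∀ {n} → Graph n → Fin n → Fin n → Graph n
adj (removeEdge G a b) i j = adj G i j ∧ not (isPair a b i j)
adj-sym (removeEdge G a b) i j = cong₂ (λ e p → e ∧ not p) (adj-sym G i j) (isPair-sym a b i j)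
irrefl (removeEdge G a b) i rewrite irrefl G i = refl

[nonAdj]-removeEdge : ∀ {n} (G : Graph n) {a b} → adj G a b ≡ true → ∀ i j →
                      [ nonAdj (removeEdge G a b) i j ] ≡ [ nonAdj G i j ] + [ isPair a b i j ]
[nonAdj]-removeEdge G {a} {b} ab i j with isPair a b i j in p
... | false rewrite ∧-identityʳ (adj G i j) = sym (+-identityʳ _)
... | true with isPair⇒ {a = a} {b} {i} {j} p
...   | inj₁ (refl , refl) rewrite ab | ≢⇒==-false (adj⇒≢ G ab) = refl
...   | inj₂ (refl , refl) rewrite adj-sym G i j | ab | ≢⇒==-false (adj⇒≢ G ab ∘ sym) = refl

codeg-removeEdge : ∀ {n} (G : Graph n) {a b} → adj G a b ≡ true → ∀ i →
                   codeg (removeEdge G a b) i ≡ codeg G i + ([ i == a ] + [ i == b ])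
codeg-removeEdge {n} G {a} {b} ab i = begin
  codeg (removeEdge G a b) i
    ≡⟨ trans (sum-cong-≗ ([nonAdj]-removeEdge G ab i)) (∑-distrib-+ _ (λ j → [ isPair a b i j ])) ⟩
  codeg G i + ∑[ j < n ] [ isPair a b i j ]
    ≡⟨ cong (codeg G i +_) (trans (sum-cong-≗ ([isPair] (adj⇒≢ G ab) i))
                                   (∑-distrib-+ (λ j → [ (j == b) ∧ (i == a) ]) (λ j → [ (j == a) ∧ (i == b) ]))) ⟩
  codeg G i + (∑[ j < n ] [ (j == b) ∧ (i == a) ] + ∑[ j < n ] [ (j == a) ∧ (i == b) ])
    ≡⟨ cong (codeg G i +_) (cong₂ _+_ (∑-[==∧] b (i == a)) (∑-[==∧] a (i == b))) ⟩
  codeg G i + ([ i == a ] + [ i == b ]) ∎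
  where open ≡-Reasoning

nonEdges-removeEdge : ∀ {n} (G : Graph n) {a b} → adj G a b ≡ true →
                      nonEdges (removeEdge G a b) ≡ suc (nonEdges G)
nonEdges-removeEdge {n} G {a} {b} ab = *-cancelˡ-≡ _ _ 2 (begin
  2 * nonEdges (removeEdge G a b)
    ≡⟨ 2*nonEdges≡∑codeg (removeEdge G a b) ⟩
  ∑[ i < n ] codeg (removeEdge G a b) i
    ≡⟨ trans (sum-cong-≗ (codeg-removeEdge G ab)) (∑-distrib-+ (codeg G) (λ i → [ i == a ] + [ i == b ])) ⟩
  ∑[ i < n ] codeg G i + ∑[ i < n ] ([ i == a ] + [ i == b ])
    ≡⟨ cong (∑[ i < n ] codeg G i +_) (trans (∑-distrib-+ (λ i → [ i == a ]) (λ i → [ i == b ]))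
                                              (cong₂ _+_ (∑-[==] a) (∑-[==] b))) ⟩
  ∑[ i < n ] codeg G i + 2
    ≡⟨ cong (_+ 2) (sym (2*nonEdges≡∑codeg G)) ⟩
  2 * nonEdges G + 2
    ≡⟨ trans (+-comm _ 2) (sym (*-suc 2 (nonEdges G))) ⟩
  2 * suc (nonEdges G) ∎)
  where open ≡-Reasoning

Edgeless : ∀ {n} → Graph n → Set
Edgeless {n} G = ∀ (a b : Fin n) → adj G a b ≡ false

edge? : ∀ {n} (G : Graph n) → (Σ (Fin n) λ a → Σ (Fin n) λ b → adj G a b ≡ true) ⊎ Edgeless G
edge? G with any? (λ a → any? (λ b → adj G a b ≟ᵇ true))
... | yes (a , b , ab) = inj₁ (a , b , ab)
... | no ¬edge = inj₂ λ a b → ¬-not (λ ab → ¬edge (a , b , ab))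

2*nonEdges-edgeless : ∀ {n} (G : Graph n) → Edgeless G → 2 * nonEdges G ≡ n * (n ∸ 1)
2*nonEdges-edgeless {n} G none =
  trans (2*nonEdges≡∑codeg G) (trans (sum-cong-≗ codeg≡n∸1) (∑-const n (n ∸ 1)))
  where
  codeg≡n∸1 : ∀ u → codeg G u ≡ n ∸ 1
  codeg≡n∸1 u = trans (codeg≡n∸suc[deg] G u)
    (cong (λ d → n ∸ suc d) (trans (deg≡∑ G u) (∑-zero (λ w → cong [_] (none u w)))))

_⊆_ : ∀ {n} → Graph n → Graph n → Set
_⊆_ {n} F G = ∀ (i j : Fin n) → adj F i j ≡ true → adj G i j ≡ true

-- An edgeless graph has n (n − 1) / 2 non-edges, so the bound on s guarantees that an edge
-- is left to remove as long as there are fewer than s non-edges.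
sparsify : ∀ {n} (G : Graph n) {s} → nonEdges G ≤ s → 2 * s ≤ n * (n ∸ 1) →
           Σ (Graph n) λ F → nonEdges F ≡ s × F ⊆ G
sparsify {n} G {s} ne≤s 2s≤ = go (s ∸ nonEdges G) G (m+[n∸m]≡n ne≤s)
  where
  go : ∀ k (G : Graph n) → nonEdges G + k ≡ s → Σ (Graph n) λ F → nonEdges F ≡ s × F ⊆ G
  go zero G e = G , trans (sym (+-identityʳ _)) e , λ _ _ ij → ij
  go (suc k) G e with edge? G
  ... | inj₂ none = ⊥-elim (<⇒≱ (*-monoʳ-< 2 (subst (nonEdges G <_) e (m<m+n _ (s≤s z≤n))))
                              (≤-trans 2s≤ (≤-reflexive (sym (2*nonEdges-edgeless G none)))))
  ... | inj₁ (a , b , ab)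
    with go k (removeEdge G a b) (trans (cong (_+ k) (nonEdges-removeEdge G ab)) (trans (sym (+-suc _ k)) e))
  ...   | F , F-nonEdges , F⊆ = F , F-nonEdges , λ i j ij → ∧≡true⇒ˡ (F⊆ i j ij)

-- Minors

⊆-≼ : ∀ {k n} {F F′ : Graph k} {G : Graph n} → F ⊆ F′ → F′ ≼ G → F ≼ G
⊆-≼ F⊆F′ M = record
  { branch    = branch
  ; nonempty  = nonempty
  ; disjoint  = disjoint
  ; connected = connected
  ; edges     = λ i j ij → edges i j (F⊆F′ i j ij)
  }
  where open MinorModel M

≼-refl : ∀ {n} (G : Graph n) → G ≼ G
≼-refl G = record
  { branch    = _==_
  ; nonempty  = λ i → i , ==-refl i
  ; disjoint  = λ i j x i≢j ix → ≢⇒==-false (λ j≡x → i≢j (trans (==⇒≡ i x ix) (sym j≡x)))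
  ; connected = connected
  ; edges     = λ i j ij → i , j , ==-refl i , ==-refl j , ij
  }
  where
  connected : ∀ i x y → (i == x) ≡ true → (i == y) ≡ true → Walk G (λ z → (i == z) ≡ true) x y
  connected i x y ix iy with refl ← ==⇒≡ i x ix | refl ← ==⇒≡ i y iy = here ix

minor⇒HasKMinusMinor : ∀ {t s n} {F : Graph t} {G : Graph n} → F ≼ G →
                       ∑[ a < t ] codeg F a ≤ 2 * s → 2 * s ≤ t * (t ∸ 1) → HasKMinusMinor t s G
minor⇒HasKMinusMinor {F = F} F≼G ∑codeg≤ 2s≤ =
  let nonEdges≤s = *-cancelˡ-≤ 2 (≤-trans (≤-reflexive (2*nonEdges≡∑codeg F)) ∑codeg≤)
      F′ , F′-nonEdges , F′⊆F = sparsify F nonEdges≤s 2s≤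
  in F′ , F′-nonEdges , ⊆-≼ F′⊆F F≼G

-- Contracting an edge

-- contract K x y merges y into x: vertex i of the contraction is the vertex punchIn y i of K,
-- and the branch set of the vertex corresponding to x also contains y.  The factor not (i == j)
-- in the adjacency discards the loop that the edge xy would create at x.
module _ {m} (K : Graph (suc m)) (x y : Fin (suc m)) where

  mergedAdj : Fin (suc m) → Fin (suc m) → Bool
  mergedAdj a b = adj K a b ∨ (((a == x) ∧ adj K y b) ∨ ((b == x) ∧ adj K y a))

  mergedAdj-sym : ∀ a b → mergedAdj a b ≡ mergedAdj b a
  mergedAdj-sym a b = cong₂ _∨_ (adj-sym K a b) (∨-comm ((a == x) ∧ adj K y b) _)

  mergedAdj⇒ : ∀ {a b} → mergedAdj a b ≡ true →
               adj K a b ≡ true ⊎ (a ≡ x × adj K y b ≡ true) ⊎ (b ≡ x × adj K y a ≡ true)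
  mergedAdj⇒ {a} {b} h with adj K a b | a ≟ x | adj K y b | b ≟ x | adj K y a
  ... | true  | _       | _     | _       | _     = inj₁ refl
  ... | false | yes a≡x | true  | _       | _     = inj₂ (inj₁ (a≡x , refl))
  ... | false | yes _   | false | yes b≡x | true  = inj₂ (inj₂ (b≡x , refl))
  ... | false | no _    | _     | yes b≡x | true  = inj₂ (inj₂ (b≡x , refl))
  ... | false | yes _   | false | yes _   | false with () ← h
  ... | false | yes _   | false | no _    | _     with () ← h
  ... | false | no _    | _     | yes _   | false with () ← h
  ... | false | no _    | _     | no _    | _     with () ← h

  contract : Graph m
  adj contract i j = not (i == j) ∧ mergedAdj (punchIn y i) (punchIn y j)
  adj-sym contract i j = cong₂ (λ e a → not e ∧ a) (==-sym i j) (mergedAdj-sym _ _)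
  irrefl contract i rewrite ==-refl i = refl

  contractBranch : Fin m → Fin (suc m) → Bool
  contractBranch i z = (z == punchIn y i) ∨ ((punchIn y i == x) ∧ (z == y))

  contractBranch-self : ∀ i → contractBranch i (punchIn y i) ≡ true
  contractBranch-self i rewrite ==-refl (punchIn y i) = refl

  contractBranch-y : ∀ i → punchIn y i ≡ x → contractBranch i y ≡ true
  contractBranch-y i refl rewrite ==-refl (punchIn y i) | ==-refl y = ∨-zeroʳ (y == punchIn y i)

  contractBranch⇒ : ∀ i z → contractBranch i z ≡ true → z ≡ punchIn y i ⊎ (z ≡ y × punchIn y i ≡ x)
  contractBranch⇒ i z h with z ≟ punchIn y i | punchIn y i ≟ x | z ≟ y
  ... | yes z≡i | _       | _       = inj₁ z≡i
  ... | no _    | yes i≡x | yes z≡y = inj₂ (z≡y , i≡x)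
  ... | no _    | yes _   | no _    with () ← h
  ... | no _    | no _    | _       with () ← h

  contractBranch-disjoint : ∀ i j z → i ≢ j → contractBranch i z ≡ true → contractBranch j z ≡ false
  contractBranch-disjoint i j z i≢j h with contractBranch⇒ i z h
  ... | inj₁ refl rewrite punchIn-== y i j | ≢⇒==-false i≢j | punchIn-==-pivot y i =
    ∧-zeroʳ (punchIn y j == x)
  ... | inj₂ (refl , refl) rewrite ==-sym y (punchIn y j) | punchIn-==-pivot y j | ==-refl y
                                 | punchIn-== y j i | ≢⇒==-false (i≢j ∘ sym) = refl

  contractBranch-connected : adj K x y ≡ true → ∀ i z₁ z₂ →
                             contractBranch i z₁ ≡ true → contractBranch i z₂ ≡ true →
                             Walk K (λ z → contractBranch i z ≡ true) z₁ z₂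
  contractBranch-connected xy i z₁ z₂ h₁ h₂ with contractBranch⇒ i z₁ h₁ | contractBranch⇒ i z₂ h₂
  ... | inj₁ refl | inj₁ refl = here h₁
  ... | inj₂ (refl , _) | inj₂ (refl , _) = here h₁
  ... | inj₁ refl | inj₂ (refl , refl) = step h₁ xy (here h₂)
  ... | inj₂ (refl , refl) | inj₁ refl = step h₁ (trans (adj-sym K y x) xy) (here h₂)

  contract-≼ : adj K x y ≡ true → contract ≼ K
  contract-≼ xy = record
    { branch    = contractBranch
    ; nonempty  = λ i → punchIn y i , contractBranch-self i
    ; disjoint  = contractBranch-disjoint
    ; connected = contractBranch-connected xy
    ; edges     = edges
    }
    where
    edges : ∀ i j → adj contract i j ≡ true → Σ (Fin (suc m)) λ u → Σ (Fin (suc m)) λ w →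
              contractBranch i u ≡ true × contractBranch j w ≡ true × adj K u w ≡ true
    edges i j h with mergedAdj⇒ (∧≡true⇒ʳ (not (i == j)) h)
    ... | inj₁ ij = punchIn y i , punchIn y j , contractBranch-self i , contractBranch-self j , ij
    ... | inj₂ (inj₁ (i≡x , yj)) = y , punchIn y j , contractBranch-y i i≡x , contractBranch-self j , yj
    ... | inj₂ (inj₂ (j≡x , yi)) =
      punchIn y i , y , contractBranch-self i , contractBranch-y j j≡x , trans (adj-sym K _ y) yi

  codegUnion : ℕ
  codegUnion = ∑[ b < suc m ] [ nonAdj K x b ∨ nonAdj K y b ]

  codeg≤codegUnion : codeg K x ≤ codegUnion
  codeg≤codegUnion = ∑-mono-≤ (λ b → []≤[∨] (nonAdj K x b) (nonAdj K y b))

  codeg<codegUnion : ∀ {z} → nonAdj K y z ≡ true → nonAdj K x z ≡ false → codeg K x < codegUnion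
  codeg<codegUnion {z} yz xz = ∑-mono-< z (λ b → []≤[∨] (nonAdj K x b) (nonAdj K y b)) (strict xz yz)
    where
    strict : ∀ {p q} → p ≡ false → q ≡ true → [ p ] < [ p ∨ q ]
    strict refl refl = s≤s z≤n

  contractNonAdj : Fin (suc m) → Fin (suc m) → Bool
  contractNonAdj a b = not (a == y) ∧ (not (b == y) ∧ (not (mergedAdj a b) ∧ not (a == b)))

  nonAdj-contract : ∀ i j → nonAdj contract i j ≡ contractNonAdj (punchIn y i) (punchIn y j)
  nonAdj-contract i j rewrite punchIn-==-pivot y i | punchIn-==-pivot y j | punchIn-== y i j = [not∧]∧ (i == j) _

  contractNonAdj-yˡ : ∀ b → contractNonAdj y b ≡ false
  contractNonAdj-yˡ b rewrite ==-refl y = refl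

  contractNonAdj-yʳ : ∀ a → contractNonAdj a y ≡ false
  contractNonAdj-yʳ a rewrite ==-refl y = ∧-zeroʳ (not (a == y))

  codeg-contract : ∀ i → codeg contract i ≡ ∑[ b < suc m ] [ contractNonAdj (punchIn y i) b ]
  codeg-contract i = sym (trans (sum-remove {i = y} (λ b → [ contractNonAdj (punchIn y i) b ]))
    (cong₂ _+_ (cong [_] (contractNonAdj-yʳ (punchIn y i))) (sum-cong-≗ λ j → cong [_] (sym (nonAdj-contract i j)))))

  ∑codeg-contract : ∑[ i < m ] codeg contract i ≡ ∑[ a < suc m ] ∑[ b < suc m ] [ contractNonAdj a b ]
  ∑codeg-contract = sym (trans (sum-remove {i = y} (λ a → ∑[ b < suc m ] [ contractNonAdj a b ]))
    (cong₂ _+_ (∑-zero (λ b → cong [_] (contractNonAdj-yˡ b))) (sum-cong-≗ λ i → sym (codeg-contract i))))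

  -- A non-adjacent ordered pair of K is not a non-adjacent pair of the contraction when it
  -- contains y or joins x to a neighbour of y.  lost a b counts such pairs with a ∈ {x, y},
  -- one for each vertex of N̄(x) ∪ N̄(y); lost b a counts the transposed pairs.
  lost : Fin (suc m) → Fin (suc m) → ℕ
  lost a b = [ (a == x) ∧ (nonAdj K x b ∧ not (nonAdj K y b)) ] + [ (a == y) ∧ nonAdj K y b ]

  ∑∑lost≡codegUnion : ∑[ a < suc m ] ∑[ b < suc m ] lost a b ≡ codegUnion
  ∑∑lost≡codegUnion = begin
    ∑[ a < suc m ] ∑[ b < suc m ] lost a b
      ≡⟨ ∑∑-distrib-+ (λ a b → [ (a == x) ∧ onlyX b ]) (λ a b → [ (a == y) ∧ nonAdj K y b ]) ⟩
    ∑[ a < suc m ] ∑[ b < suc m ] [ (a == x) ∧ onlyX b ] + ∑[ a < suc m ] ∑[ b < suc m ] [ (a == y) ∧ nonAdj K y b ]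
      ≡⟨ cong₂ _+_ (∑∑-[==∧] x onlyX) (∑∑-[==∧] y (nonAdj K y)) ⟩
    ∑[ b < suc m ] [ onlyX b ] + ∑[ b < suc m ] [ nonAdj K y b ]
      ≡⟨ sym (∑-distrib-+ (λ b → [ onlyX b ]) (λ b → [ nonAdj K y b ])) ⟩
    ∑[ b < suc m ] ([ onlyX b ] + [ nonAdj K y b ])
      ≡⟨ sum-cong-≗ (λ b → [∧¬]+[]≡[∨] (nonAdj K x b) (nonAdj K y b)) ⟩
    codegUnion ∎
    where
    open ≡-Reasoning
    onlyX : Fin (suc m) → Bool
    onlyX b = nonAdj K x b ∧ not (nonAdj K y b)

  module _ (xy : adj K x y ≡ true) where

    private
      x==y : (x == y) ≡ false
      x==y = ≢⇒==-false (adj⇒≢ K xy)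
      y==x : (y == x) ≡ false
      y==x = ≢⇒==-false (adj⇒≢ K xy ∘ sym)
      nonAdj-xy : nonAdj K x y ≡ false
      nonAdj-xy = adj⇒¬nonAdj K xy

      row-y : ∀ b → [ contractNonAdj y b ] + (lost y b + lost b y) ≤ [ nonAdj K y b ]
      row-y b rewrite nonAdj-irrefl K y | nonAdj-xy | ==-refl y | y==x
                           | ∧-zeroʳ (b == x) | ∧-zeroʳ (b == y) = ≤-reflexive (+-identityʳ _)

      column-y : ∀ a → a ≢ y → [ contractNonAdj a y ] + (lost a y + lost y a) ≤ [ nonAdj K a y ]
      column-y a a≢y rewrite nonAdj-irrefl K y | nonAdj-xy | nonAdj-sym K y a | ==-refl y
                               | ≢⇒==-false a≢y | y==x | ∧-zeroʳ (a == x) = ≤-refl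

      row-x : ∀ b → b ≢ y → [ contractNonAdj x b ] + (lost x b + lost b x) ≤ [ nonAdj K x b ]
      row-x b b≢y with b ≟ x
      ... | yes refl rewrite nonAdj-irrefl K b | ==-refl b | ≢⇒==-false b≢y
                           | ∧-zeroʳ (not (adj K b b ∨ (adj K y b ∨ adj K y b))) = z≤n
      ... | no b≢x rewrite ==-refl x | x==y | ≢⇒==-false b≢y | ≢⇒==-false (b≢x ∘ sym)
                         | ≢⇒==-false (b≢y ∘ sym) | ∨-identityʳ (adj K y b) | ∧-identityʳ (not (adj K x b))
                         | ∧-identityʳ (not (adj K y b)) | ∧-identityʳ (not (adj K x b ∨ adj K y b))
                         = ≤-reflexive (trans (cong ([ not (adj K x b ∨ adj K y b) ] +_)
                                                      (trans (+-identityʳ _)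
                                                             (+-identityʳ [ not (adj K x b) ∧ not (not (adj K y b)) ])))
                                              ([¬∨]+[¬∧¬¬]≡[¬] (adj K x b) (adj K y b)))

      column-x : ∀ a → a ≢ y → a ≢ x → [ contractNonAdj a x ] + (lost a x + lost x a) ≤ [ nonAdj K a x ]
      column-x a a≢y a≢x rewrite ==-refl x | x==y | ≢⇒==-false a≢y | ≢⇒==-false a≢x | ≢⇒==-false (a≢x ∘ sym)
                                   | ≢⇒==-false (a≢y ∘ sym) | adj-sym K a x
                                   | ∧-identityʳ (not (adj K x a)) | ∧-identityʳ (not (adj K y a))
                                   | ∧-identityʳ (not (adj K x a ∨ adj K y a))
                                   = ≤-reflexive (trans (cong ([ not (adj K x a ∨ adj K y a) ] +_) (+-identityʳ _))
                                                        ([¬∨]+[¬∧¬¬]≡[¬] (adj K x a) (adj K y a)))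

      away-from-x,y : ∀ a b → a ≢ y → b ≢ y → a ≢ x → b ≢ x →
                          [ contractNonAdj a b ] + (lost a b + lost b a) ≤ [ nonAdj K a b ]
      away-from-x,y a b a≢y b≢y a≢x b≢x rewrite ≢⇒==-false a≢y | ≢⇒==-false b≢y | ≢⇒==-false a≢x
                                                  | ≢⇒==-false b≢x | ∨-identityʳ (adj K a b) =
        ≤-reflexive (+-identityʳ _)

    [contractNonAdj]+lost≤[nonAdj] : ∀ a b → [ contractNonAdj a b ] + (lost a b + lost b a) ≤ [ nonAdj K a b ]
    [contractNonAdj]+lost≤[nonAdj] a b = byCases (a ≟ y) (b ≟ y) (a ≟ x) (b ≟ x)
      where
      byCases : Dec (a ≡ y) → Dec (b ≡ y) → Dec (a ≡ x) → Dec (b ≡ x) →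
                [ contractNonAdj a b ] + (lost a b + lost b a) ≤ [ nonAdj K a b ]
      byCases (yes refl) _          _          _          = row-y b
      byCases (no a≢y)   (yes refl) _          _          = column-y a a≢y
      byCases (no _)     (no b≢y)   (yes refl) _          = row-x b b≢y
      byCases (no a≢y)   (no _)     (no a≢x)   (yes refl) = column-x a a≢y a≢x
      byCases (no a≢y)   (no b≢y)   (no a≢x)   (no b≢x)   = away-from-x,y a b a≢y b≢y a≢x b≢x

    ∑codeg-contract+2*codegUnion≤∑codeg :
      ∑[ i < m ] codeg contract i + 2 * codegUnion ≤ ∑[ a < suc m ] codeg K a
    ∑codeg-contract+2*codegUnion≤∑codeg = begin
      ∑[ i < m ] codeg contract i + 2 * codegUnion
        ≡⟨ cong₂ _+_ ∑codeg-contract (sym 2*codegUnion≡) ⟩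
      ∑[ a < suc m ] ∑[ b < suc m ] [ contractNonAdj a b ] + ∑[ a < suc m ] ∑[ b < suc m ] (lost a b + lost b a)
        ≡⟨ sym (∑∑-distrib-+ (λ a b → [ contractNonAdj a b ]) (λ a b → lost a b + lost b a)) ⟩
      ∑[ a < suc m ] ∑[ b < suc m ] ([ contractNonAdj a b ] + (lost a b + lost b a))
        ≤⟨ ∑-mono-≤ (λ a → ∑-mono-≤ ([contractNonAdj]+lost≤[nonAdj] a)) ⟩
      ∑[ a < suc m ] codeg K a ∎
      where
      open ≤-Reasoning
      2*codegUnion≡ : ∑[ a < suc m ] ∑[ b < suc m ] (lost a b + lost b a) ≡ 2 * codegUnion
      2*codegUnion≡ = begin-equality
        ∑[ a < suc m ] ∑[ b < suc m ] (lost a b + lost b a)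
          ≡⟨ ∑∑-distrib-+ lost (λ a b → lost b a) ⟩
        ∑[ a < suc m ] ∑[ b < suc m ] lost a b + ∑[ a < suc m ] ∑[ b < suc m ] lost b a
          ≡⟨ cong (∑[ a < suc m ] ∑[ b < suc m ] lost a b +_) (sym (∑-comm lost)) ⟩
        ∑[ a < suc m ] ∑[ b < suc m ] lost a b + ∑[ a < suc m ] ∑[ b < suc m ] lost a b
          ≡⟨ cong₂ _+_ ∑∑lost≡codegUnion (trans ∑∑lost≡codegUnion (sym (+-identityʳ codegUnion))) ⟩
        2 * codegUnion ∎

-- Graphs on eight vertices

[¬adj]≡[nonAdj]+[==] : ∀ {n} (G : Graph n) x a → [ not (adj G x a) ] ≡ [ nonAdj G x a ] + [ a == x ]
[¬adj]≡[nonAdj]+[==] G x a with a ≟ x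
... | yes refl rewrite irrefl G a | ==-refl a = refl
... | no a≢x rewrite ≢⇒==-false (a≢x ∘ sym) | ∧-identityʳ (not (adj G x a)) = sym (+-identityʳ _)

∑[¬adj]≡suc[codeg] : ∀ {n} (G : Graph n) x → ∑[ a < n ] [ not (adj G x a) ] ≡ suc (codeg G x)
∑[¬adj]≡suc[codeg] {n} G x = begin
  ∑[ a < n ] [ not (adj G x a) ]
    ≡⟨ trans (sum-cong-≗ ([¬adj]≡[nonAdj]+[==] G x)) (∑-distrib-+ (λ a → [ nonAdj G x a ]) (λ a → [ a == x ])) ⟩
  codeg G x + ∑[ a < n ] [ a == x ]
    ≡⟨ trans (cong (codeg G x +_) (∑-[==] x)) (+-comm (codeg G x) 1) ⟩
  suc (codeg G x) ∎
  where open ≡-Reasoning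

NestedNonNbrs : ∀ {n} → Graph n → Fin n → Set
NestedNonNbrs {n} G x = ∀ (a b : Fin n) → adj G x a ≡ true → nonAdj G a b ≡ true → nonAdj G x b ≡ true

-- A neighbour of x has all its non-neighbours in N̄(x), and a vertex b ∈ N̄(x) is a
-- non-neighbour of at most c − 1 neighbours of x, since x itself is one of its non-neighbours.
module _ {n} (G : Graph n) (x : Fin n) {c} (codeg≤c : ∀ a → codeg G a ≤ c) (nested : NestedNonNbrs G x) where

  private
    sharedNonNbr : Fin n → Fin n → ℕ
    sharedNonNbr a b = [ adj G x a ∧ (nonAdj G a b ∧ nonAdj G x b) ]

    codeg≤ : ∀ a → codeg G a ≤ c * [ not (adj G x a) ] + ∑[ b < n ] sharedNonNbr a b
    codeg≤ a with adj G x a in xa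
    ... | false = ≤-trans (codeg≤c a) (≤-trans (≤-reflexive (sym (*-identityʳ c))) (m≤m+n _ _))
    ... | true = ≤-trans (∑-mono-≤ inherited) (m≤n+m _ (c * 0))
      where
      inherited : ∀ b → [ nonAdj G a b ] ≤ [ nonAdj G a b ∧ nonAdj G x b ]
      inherited b with nonAdj G a b in ab
      ... | false = z≤n
      ... | true rewrite nested a b xa ab = ≤-refl

    sharedNonNbr+[==]≤ : ∀ b → nonAdj G x b ≡ true → ∀ a → sharedNonNbr a b + [ a == x ] ≤ [ nonAdj G b a ]
    sharedNonNbr+[==]≤ b xb a with a ≟ x
    ... | yes refl rewrite irrefl G a | nonAdj-sym G b a | xb = ≤-refl
    ... | no a≢x rewrite xb | nonAdj-sym G b a | ∧-identityʳ (nonAdj G a b) | +-identityʳ [ adj G x a ∧ nonAdj G a b ]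
      = [∧]≤[] (adj G x a) (nonAdj G a b)
      where
      [∧]≤[] : ∀ p q → [ p ∧ q ] ≤ [ q ]
      [∧]≤[] true q = ≤-refl
      [∧]≤[] false q = z≤n

    ∑sharedNonNbr≤ : ∀ b → ∑[ a < n ] sharedNonNbr a b ≤ (c ∸ 1) * [ nonAdj G x b ]
    ∑sharedNonNbr≤ b = byValue (nonAdj G x b) refl
      where
      byValue : ∀ t → nonAdj G x b ≡ t → ∑[ a < n ] sharedNonNbr a b ≤ (c ∸ 1) * [ t ]
      byValue false xb = ≤-trans (≤-reflexive (∑-zero noneShared)) z≤n
        where
        noneShared : ∀ a → [ adj G x a ∧ (nonAdj G a b ∧ nonAdj G x b) ] ≡ 0
        noneShared a rewrite xb | ∧-zeroʳ (nonAdj G a b) | ∧-zeroʳ (adj G x a) = refl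
      byValue true xb = ≤-trans (∸-monoˡ-≤ 1 suc[∑]≤c) (≤-reflexive (sym (*-identityʳ (c ∸ 1))))
        where
        open ≤-Reasoning
        suc[∑]≤c : suc (∑[ a < n ] sharedNonNbr a b) ≤ c
        suc[∑]≤c = begin
          suc (∑[ a < n ] sharedNonNbr a b)
            ≡⟨ trans (+-comm 1 _) (cong (∑[ a < n ] sharedNonNbr a b +_) (sym (∑-[==] x))) ⟩
          ∑[ a < n ] sharedNonNbr a b + ∑[ a < n ] [ a == x ]
            ≡⟨ sym (∑-distrib-+ (λ a → sharedNonNbr a b) (λ a → [ a == x ])) ⟩
          ∑[ a < n ] (sharedNonNbr a b + [ a == x ])
            ≤⟨ ∑-mono-≤ (sharedNonNbr+[==]≤ b xb) ⟩
          codeg G b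
            ≤⟨ codeg≤c b ⟩
          c ∎

  ∑codeg-nested : ∑[ a < n ] codeg G a ≤ c * suc (codeg G x) + (c ∸ 1) * codeg G x
  ∑codeg-nested = begin
    ∑[ a < n ] codeg G a
      ≤⟨ ∑-mono-≤ codeg≤ ⟩
    ∑[ a < n ] (c * [ not (adj G x a) ] + ∑[ b < n ] sharedNonNbr a b)
      ≡⟨ ∑-distrib-+ (λ a → c * [ not (adj G x a) ]) (λ a → ∑[ b < n ] sharedNonNbr a b) ⟩
    ∑[ a < n ] (c * [ not (adj G x a) ]) + ∑[ a < n ] ∑[ b < n ] sharedNonNbr a b
      ≡⟨ cong₂ _+_ (trans (sym (*-distribˡ-sum c (λ a → [ not (adj G x a) ]))) (cong (c *_) (∑[¬adj]≡suc[codeg] G x)))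
                   (∑-comm sharedNonNbr) ⟩
    c * suc (codeg G x) + ∑[ b < n ] ∑[ a < n ] sharedNonNbr a b
      ≤⟨ +-monoʳ-≤ (c * suc (codeg G x)) (∑-mono-≤ ∑sharedNonNbr≤) ⟩
    c * suc (codeg G x) + ∑[ b < n ] ((c ∸ 1) * [ nonAdj G x b ])
      ≡⟨ cong (c * suc (codeg G x) +_) (sym (*-distribˡ-sum (c ∸ 1) (λ b → [ nonAdj G x b ]))) ⟩
    c * suc (codeg G x) + (c ∸ 1) * codeg G x ∎
    where open ≤-Reasoning

neighbour : ∀ {n} (G : Graph n) x → suc (codeg G x) < n → Σ (Fin n) λ y → adj G x y ≡ true
neighbour {n} G x lt with any? (λ y → adj G x y ≟ᵇ true)
... | yes found = found
... | no none = ⊥-elim (<-irrefl (trans (cong (λ d → suc (d + codeg G x)) (sym deg≡0)) (suc[deg+codeg]≡n G x)) lt)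
  where
  deg≡0 : deg G x ≡ 0
  deg≡0 = trans (deg≡∑ G x) (∑-zero (λ y → cong [_] (¬-not (λ xy → none (y , xy)))))

NestingFailure : ∀ {n} → Graph n → Fin n → Set
NestingFailure {n} G x =
  Σ (Fin n) λ a → Σ (Fin n) λ b → adj G x a ≡ true × nonAdj G a b ≡ true × nonAdj G x b ≡ false

nested⊎failure : ∀ {n} (G : Graph n) x → NestedNonNbrs G x ⊎ NestingFailure G x
nested⊎failure G x
  with any? (λ a → any? λ b →
         (adj G x a ≟ᵇ true) ×-dec (nonAdj G a b ≟ᵇ true) ×-dec (nonAdj G x b ≟ᵇ false))
... | yes escape = inj₂ escape
... | no ¬escape = inj₁ nested
  where
  nested : NestedNonNbrs G x
  nested a b xa ab = ¬-not (λ xb → ¬escape (a , b , xa , ab , xb))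

2*m≤1+2*n⇒m≤n : ∀ {m n} → 2 * m ≤ suc (2 * n) → m ≤ n
2*m≤1+2*n⇒m≤n {n = n} 2m≤ = ≮⇒≥ λ n<m →
  <⇒≱ (≤-trans (≤-reflexive (sym (*-suc 2 n))) (*-monoʳ-≤ 2 n<m)) 2m≤

s+2u≤d≤b+2k⇒s≤b : ∀ {s u d b k} → s + 2 * u ≤ d → d ≤ b + 2 * k → k ≤ u → s ≤ b
s+2u≤d≤b+2k⇒s≤b {s} {b = b} {k} s+2u≤d d≤b+2k k≤u =
  +-cancelʳ-≤ (2 * k) s b (≤-trans (+-monoʳ-≤ s (*-monoʳ-≤ 2 k≤u)) (≤-trans s+2u≤d d≤b+2k))

sparseContraction : (K : Graph 8) → (∀ a → codeg K a ≤ 3) → ∑[ a < 8 ] codeg K a ≤ 21 →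
                    Σ (Fin 8) λ x → Σ (Fin 8) λ y → adj K x y ≡ true × ∑[ i < 7 ] codeg (contract K x y) i ≤ 12
sparseContraction K codeg≤3 ∑codeg≤21 = x , byCases (codeg K x ≤? 2) (nested⊎failure K x)
  where
  x : Fin 8
  x = proj₁ (maximiser (codeg K))
  x-max : ∀ u → codeg K u ≤ codeg K x
  x-max = proj₂ (maximiser (codeg K))
  x-neighbour : Σ (Fin 8) λ y → adj K x y ≡ true
  x-neighbour = neighbour K x (s≤s (s≤s (≤-trans (codeg≤3 x) (m≤m+n 3 3))))

  ∑codeg≤20 : ∑[ a < 8 ] codeg K a ≤ 12 + 2 * 4
  ∑codeg≤20 = subst (_≤ 20) (2*nonEdges≡∑codeg K)
    (*-monoʳ-≤ 2 (2*m≤1+2*n⇒m≤n {nonEdges K} {10}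
      (≤-trans (≤-reflexive (2*nonEdges≡∑codeg K)) ∑codeg≤21)))

  Contractible : Set
  Contractible = Σ (Fin 8) λ y → adj K x y ≡ true × ∑[ i < 7 ] codeg (contract K x y) i ≤ 12

  contractible : ∀ {b k} y (xy : adj K x y ≡ true) → ∑[ a < 8 ] codeg K a ≤ b + 2 * k → k ≤ codegUnion K x y →
                 b ≤ 12 → Contractible
  contractible y xy ∑codeg≤ k≤ b≤12 =
    y , xy , ≤-trans (s+2u≤d≤b+2k⇒s≤b (∑codeg-contract+2*codegUnion≤∑codeg K x y xy) ∑codeg≤ k≤) b≤12

  byCases : Dec (codeg K x ≤ 2) → NestedNonNbrs K x ⊎ NestingFailure K x → Contractible
  byCases (yes codeg≤2) _ =
    contractible (proj₁ x-neighbour) (proj₂ x-neighbour)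
      (≤-trans (∑-≤-* (codeg K x) x-max) (≤-reflexive (*-distribʳ-+ (codeg K x) 6 2)))
      (codeg≤codegUnion K x _) (*-monoʳ-≤ 6 codeg≤2)
  byCases (no codeg≰2) (inj₂ (y , z , xy , yz , xz)) =
    contractible y xy ∑codeg≤20 (≤-trans (s≤s (≰⇒> codeg≰2)) (codeg<codegUnion K x y yz xz)) ≤-refl
  byCases (no codeg≰2) (inj₁ nested) =
    contractible (proj₁ x-neighbour) (proj₂ x-neighbour)
      (subst (λ d → ∑[ a < 8 ] codeg K a ≤ 3 * suc d + 2 * d) codeg≡3 (∑codeg-nested K x codeg≤3 nested))
      (≤-trans (≤-reflexive (sym codeg≡3)) (codeg≤codegUnion K x _)) ≤-refl
    where
    codeg≡3 : codeg K x ≡ 3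
    codeg≡3 = ≤-antisym (codeg≤3 x) (≰⇒> codeg≰2)

lemma4p2 : (m : ℕ) → (suc m ≡ 8 ⊎ suc m ≡ 9) → (H : Graph (suc m)) → minDeg≥ H 5
    → Σ (Fin (suc m)) λ v → HasKMinusMinor 7 6 (H ∖ v)
lemma4p2 m (inj₁ refl) H δ≥5 = v , minor⇒HasKMinusMinor (≼-refl (H ∖ v)) ∑codeg≤12 (m≤m+n 12 30)
  where
  v : Fin 8
  v = proj₁ (maximiser (codeg H))
  ∑codeg≤12 : ∑[ a < 7 ] codeg (H ∖ v) a ≤ 2 * 6
  ∑codeg≤12 = ≤-trans (∑codeg-∖-maximiser H v (proj₂ (maximiser (codeg H))))
                      (*-monoʳ-≤ 6 (minDeg⇒codeg≤ H δ≥5 v))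
lemma4p2 m (inj₂ refl) H δ≥5 =
  let x , y , xy , ∑codeg≤12 = sparseContraction (H ∖ v) codeg≤3 ∑codeg≤21
  in v , minor⇒HasKMinusMinor (contract-≼ (H ∖ v) x y xy) ∑codeg≤12 (m≤m+n 12 30)
  where
  v : Fin 9
  v = proj₁ (maximiser (codeg H))
  codeg≤3 : ∀ a → codeg (H ∖ v) a ≤ 3
  codeg≤3 a = ≤-trans (codeg-∖≤ H v a) (minDeg⇒codeg≤ H δ≥5 (punchIn v a))
  ∑codeg≤21 : ∑[ a < 8 ] codeg (H ∖ v) a ≤ 21
  ∑codeg≤21 = ≤-trans (∑codeg-∖-maximiser H v (proj₂ (maximiser (codeg H))))
                      (*-monoʳ-≤ 7 (minDeg⇒codeg≤ H δ≥5 v))
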